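{- There is a randomized online algorithm for the generalized $k$-server problem in the uniform metric case whose competitive ratio against an oblivious adversary is $O(k^3\log k)$.
   Context: Generalized $k$-server problem: there are $k$ servers $s_1,\dots,s_k$, where server $s_i$ lies in its own metric space $M_i$. Requests arrive online; a request is a $k$-tuple $r=(r_1,\dots,r_k)$ with $r_i\in M_i$, and to serve it the algorithm must move servers so that $s_i$ is at $r_i$ for at least one $i$. The cost is the total distance traveled by all servers. Uniform metric case: every $M_i$ is a finite uniform metric (possibly with different numbers of points) with all pairwise distances equal to $1$. A randomized online algorithm is $c$-competitive against an oblivious adversary if there is a constant $a$ such that for every request sequence $\sigma$ fixed in advance, $\mathbb{E}[\mathrm{cost}_{\mathrm{ALG}}(\sigma)]\le c\cdot\mathrm{OPT}(\sigma)+a$, where $\mathrm{OPT}(\sigma)$ is the optimal offline cost. -}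

module Defs where

open import Data.Nat using (ℕ; zero; suc)
import Data.Nat as ℕ
open import Data.Fin using (Fin; _≟_)
open import Data.List using (List; []; _∷_; _++_; [_]; map; allFin)
open import Data.Nat.ListAction using (sum)
open import Data.List.Relation.Unary.All using (All)
open import Data.Product using (Σ; ∃; _×_; _,_; proj₁)
open import Data.Integer using (+_)
open import Data.Rational using (ℚ; _/_; 0ℚ; 1ℚ; _≤_)
import Data.Rational as ℚ
open import Relation.Binary.PropositionalEquality using (_≡_)
open import Relation.Nullary using (does)
open import Data.Bool using (if_then_else_)

ℕtoℚ : ℕ → ℚ
ℕtoℚ m = (+ m) / 1

-- An instance of the uniform generalized k-server problem:
-- server i lives in the uniform metric space Fin (n i) (all distances 1).
Config : (k : ℕ) → (Fin k → ℕ) → Set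
Config k n = (i : Fin k) → Fin (n i)

Request : (k : ℕ) → (Fin k → ℕ) → Set
Request = Config

Serves : ∀ {k n} → Request k n → Config k n → Set
Serves {k} r c = Σ (Fin k) λ i → c i ≡ r i

dist : ∀ {k n} → Config k n → Config k n → ℕ
dist {k} c c' = sum (map (λ i → if does (c i ≟ c' i) then 0 else 1) (allFin k))

sumℚ : List ℚ → ℚ
sumℚ [] = 0ℚ
sumℚ (x ∷ xs) = x ℚ.+ sumℚ xs

record Distr (A : Set) : Set where
  field
    support   : List (ℚ × A)
    nonneg    : All (λ p → 0ℚ ≤ proj₁ p) support
    sums-to-1 : sumℚ (map proj₁ support) ≡ 1ℚ

-- A randomized online algorithm (behavioural form): given the history of
-- past requests with the configurations it moved to, and the current request r,
-- it outputs a probability distribution over configurations serving r.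
RandAlg : (k : ℕ) → (Fin k → ℕ) → Set
RandAlg k n = List (Request k n × Config k n) → (r : Request k n) → Distr (Σ (Config k n) (Serves r))

mutual
  expCost : ∀ {k n} → RandAlg k n → List (Request k n × Config k n) → Config k n
          → List (Request k n) → ℚ
  expCost A h cur [] = 0ℚ
  expCost A h cur (r ∷ σ) = expStep A h cur r σ (Distr.support (A h r))

  expStep : ∀ {k n} → RandAlg k n → List (Request k n × Config k n) → Config k n
          → (r : Request k n) → List (Request k n) → List (ℚ × Σ (Config k n) (Serves r)) → ℚ
  expStep A h cur r σ [] = 0ℚ
  expStep A h cur r σ ((p , (c' , _)) ∷ rest) =
    p ℚ.* (ℕtoℚ (dist cur c') ℚ.+ expCost A (h ++ [ (r , c') ]) c' σ)
    ℚ.+ expStep A h cur r σ rest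

ALGcost : ∀ {k n} → RandAlg k n → Config k n → List (Request k n) → ℚ
ALGcost A c0 σ = expCost A [] c0 σ

data Feasible {k n} : List (Request k n) → List (Config k n) → Set where
  []  : Feasible [] []
  _∷_ : ∀ {r c σ τ} → Serves r c → Feasible σ τ → Feasible (r ∷ σ) (c ∷ τ)

trajCost : ∀ {k n} → Config k n → List (Config k n) → ℕ
trajCost c0 [] = 0
trajCost c0 (c ∷ τ) = dist c0 c ℕ.+ trajCost c τ

-- OPT(σ) is the minimum of trajCost over feasible τ (attained), so this is
-- stated as: for every feasible offline solution τ.
Competitive : ∀ {k n} → ℚ → RandAlg k n → Config k n → Set
Competitive {k} {n} c A c0 =
  ∃ λ (a : ℚ) → ∀ (σ : List (Request k n)) (τ : List (Config k n)) → Feasible σ τ →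
    ALGcost A c0 σ ≤ c ℚ.* ℕtoℚ (trajCost c0 τ) ℚ.+ a

module Submission where

-- The algorithm maintains a family of subspaces (configurations
-- with some servers fixed and the others free), all of whose points serve
-- every request of the current phase.  On a request r, a subspace with a
-- fixed server already at r survives; any other subspace is replaced by its
-- children, each fixing one more server at r; when nothing is left, a new
-- phase starts.  The algorithm stays where it is while its position is the
-- anchor of a subspace of maximal dimension, and otherwise moves to the
-- anchor of a uniformly random one.

open import Data.Nat using (ℕ; zero; suc)
import Data.Nat as ℕ
import Data.Nat.Properties as ℕP
open import Data.Rational using (ℚ; 0ℚ; 1ℚ)
import Data.Rational as ℚ
import Data.Rational.Properties as ℚP
open import Data.Bool using (true; false; if_then_else_)
open import Data.List using (List; []; _∷_; [_]; _++_; length; map; allFin)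
open import Data.List.Membership.Propositional using (_∈_)
open import Data.List.Relation.Unary.Any using (here; there)
open import Data.Product using (Σ; ∃; _×_; _,_; proj₁; proj₂)
open import Data.Sum using (_⊎_; inj₁; inj₂)
open import Data.Empty using (⊥-elim)
open import Relation.Binary.PropositionalEquality hiding ([_])
open import Function using (_∘_; id)
open import Data.Fin using (Fin; _≟_)
open import Defs

-- The embedding ℕtoℚ is a homomorphism of ordered semirings.  We compute
-- in unnormalised rationals, where ℕtoℚ m is simply m/1.
module Embedding where

  open import Data.Integer using (+_)
  import Data.Integer as ℤ
  import Data.Integer.Properties as ℤP
  open import Data.Rational using (_/_; toℚᵘ)
  import Data.Rational.Unnormalised as ℚᵘ
  import Data.Rational.Unnormalised.Properties as ℚᵘP

  private
    toᵘ : ∀ m → toℚᵘ (ℕtoℚ m) ℚᵘ.≃ ℚᵘ.mkℚᵘ (+ m) 0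
    toᵘ m = ℚP.toℚᵘ-fromℚᵘ (ℚᵘ.mkℚᵘ (+ m) 0)

    ℤ-* : ∀ a b → + a ℤ.* + b ≡ + (a ℕ.* b)
    ℤ-* a b = ℤP.+◃n≡+n (a ℕ.* b)

    ℤ-*1 : ∀ a → a ℤ.* + 1 ≡ a
    ℤ-*1 = ℤP.*-identityʳ

  ℕtoℚ-+ : ∀ a b → ℕtoℚ (a ℕ.+ b) ≡ ℕtoℚ a ℚ.+ ℕtoℚ b
  ℕtoℚ-+ a b = ℚP.toℚᵘ-injective (ℚᵘP.≃-trans (toᵘ (a ℕ.+ b)) (ℚᵘP.≃-sym (ℚᵘP.≃-trans (ℚP.toℚᵘ-homo-+ (ℕtoℚ a) (ℕtoℚ b)) (ℚᵘP.≃-trans (ℚᵘP.+-cong (toᵘ a) (toᵘ b)) (ℚᵘ.*≡* eq)))))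
    where
    eq : (+ a ℤ.* + 1 ℤ.+ + b ℤ.* + 1) ℤ.* + 1 ≡ + (a ℕ.+ b) ℤ.* (+ 1 ℤ.* + 1)
    eq rewrite ℤ-*1 (+ a) | ℤ-*1 (+ b) | ℤ-*1 (+ (a ℕ.+ b)) = refl

  ℕtoℚ-* : ∀ a b → ℕtoℚ (a ℕ.* b) ≡ ℕtoℚ a ℚ.* ℕtoℚ b
  ℕtoℚ-* a b = ℚP.toℚᵘ-injective (ℚᵘP.≃-trans (toᵘ (a ℕ.* b)) (ℚᵘP.≃-sym (ℚᵘP.≃-trans (ℚP.toℚᵘ-homo-* (ℕtoℚ a) (ℕtoℚ b)) (ℚᵘP.≃-trans (ℚᵘP.*-cong (toᵘ a) (toᵘ b)) (ℚᵘ.*≡* eq)))))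
    where
    eq : (+ a ℤ.* + b) ℤ.* + 1 ≡ + (a ℕ.* b) ℤ.* (+ 1 ℤ.* + 1)
    eq rewrite ℤ-* a b | ℤ-*1 (+ (a ℕ.* b)) = refl

  ℕtoℚ-mono : ∀ {a b} → a ℕ.≤ b → ℕtoℚ a ℚ.≤ ℕtoℚ b
  ℕtoℚ-mono {a} {b} a≤b = ℚP.toℚᵘ-cancel-≤ (ℚᵘP.≤-respʳ-≃ (ℚᵘP.≃-sym (toᵘ b)) (ℚᵘP.≤-respˡ-≃ (ℚᵘP.≃-sym (toᵘ a)) (ℚᵘ.*≤* le)))
    where
    le : + a ℤ.* + 1 ℤ.≤ + b ℤ.* + 1
    le rewrite ℤ-*1 (+ a) | ℤ-*1 (+ b) = ℤ.+≤+ a≤b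

  0≤ℕtoℚ : ∀ a → 0ℚ ℚ.≤ ℕtoℚ a
  0≤ℕtoℚ a = ℕtoℚ-mono {0} {a} ℕ.z≤n

  -- inv m = 1/m for m > 0 (and 0 for m = 0): the weight of a uniform choice
  inv : ℕ → ℚ
  inv zero = 0ℚ
  inv (suc m) = (+ 1) / suc m

  private
    invᵘ : ∀ m → toℚᵘ (inv (suc m)) ℚᵘ.≃ ℚᵘ.mkℚᵘ (+ 1) m
    invᵘ m = ℚP.toℚᵘ-fromℚᵘ (ℚᵘ.mkℚᵘ (+ 1) m)

  inv-inverse : ∀ m → ℕtoℚ (suc m) ℚ.* inv (suc m) ≡ 1ℚ
  inv-inverse m = ℚP.toℚᵘ-injective (ℚᵘP.≃-trans (ℚP.toℚᵘ-homo-* (ℕtoℚ (suc m)) (inv (suc m))) (ℚᵘP.≃-trans (ℚᵘP.*-cong (toᵘ (suc m)) (invᵘ m)) (ℚᵘ.*≡* eq)))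
    where
    eq : (+ suc m ℤ.* + 1) ℤ.* + 1 ≡ + 1 ℤ.* (+ 1 ℤ.* + suc m)
    eq = trans (trans (ℤ-*1 (+ suc m ℤ.* + 1)) (ℤ-*1 (+ suc m))) (sym (trans (ℤP.*-identityˡ (+ 1 ℤ.* + suc m)) (ℤP.*-identityˡ (+ suc m))))

  0≤inv : ∀ m → 0ℚ ℚ.≤ inv m
  0≤inv zero = ℚP.≤-refl
  0≤inv (suc m) = ℚP.toℚᵘ-cancel-≤ (ℚᵘP.≤-respʳ-≃ (ℚᵘP.≃-sym (invᵘ m)) (ℚᵘ.*≤* (ℤ.+≤+ ℕ.z≤n)))

  inv-antitone : ∀ {a b} → a ℕ.≤ b → inv (suc b) ℚ.≤ inv (suc a)
  inv-antitone {a} {b} le = ℚP.toℚᵘ-cancel-≤ (ℚᵘP.≤-respʳ-≃ (ℚᵘP.≃-sym (invᵘ a)) (ℚᵘP.≤-respˡ-≃ (ℚᵘP.≃-sym (invᵘ b)) (ℚᵘ.*≤* lz)))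
    where
    lz : + 1 ℤ.* + suc a ℤ.≤ + 1 ℤ.* + suc b
    lz rewrite ℤP.*-identityˡ (+ suc a) | ℤP.*-identityˡ (+ suc b) = ℤ.+≤+ (ℕ.s≤s le)

  *-monoˡ-0≤ : ∀ {w a b} → 0ℚ ℚ.≤ w → a ℚ.≤ b → w ℚ.* a ℚ.≤ w ℚ.* b
  *-monoˡ-0≤ {w} h le = ℚP.*-monoˡ-≤-nonNeg w {{ℚ.nonNegative h}} le

  *-monoʳ-0≤ : ∀ {w a b} → 0ℚ ℚ.≤ w → a ℚ.≤ b → a ℚ.* w ℚ.≤ b ℚ.* w
  *-monoʳ-0≤ {w} h le = ℚP.*-monoʳ-≤-nonNeg w {{ℚ.nonNegative h}} le

  0≤* : ∀ {a b} → 0ℚ ℚ.≤ a → 0ℚ ℚ.≤ b → 0ℚ ℚ.≤ a ℚ.* b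
  0≤* {a} ha hb = ℚP.≤-trans (ℚP.≤-reflexive (sym (ℚP.*-zeroʳ a))) (*-monoˡ-0≤ ha hb)

  0≤+ : ∀ {a b} → 0ℚ ℚ.≤ a → 0ℚ ℚ.≤ b → 0ℚ ℚ.≤ a ℚ.+ b
  0≤+ = ℚP.+-mono-≤

module ListSums where

  open Embedding
  open import Relation.Nullary using (does; ¬?; ¬_)
  open import Relation.Unary using (Pred; Decidable)
  open import Level using (0ℓ)
  open import Data.List using (filter)
  open import Data.Rational.Solver using (module +-*-Solver)
  open +-*-Solver

  sumOf : ∀ {A : Set} → (A → ℚ) → List A → ℚ
  sumOf f xs = sumℚ (map f xs)

  private
    suc-* : ∀ l b → ℕtoℚ (suc l) ℚ.* b ≡ b ℚ.+ ℕtoℚ l ℚ.* b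
    suc-* l b = trans (cong (ℚ._* b) (ℕtoℚ-+ 1 l)) (solve 2 (λ b l → (con 1ℚ :+ l) :* b := b :+ l :* b) refl b (ℕtoℚ l))

  module _ {A : Set} where

    sum-+ : ∀ (f g : A → ℚ) xs → sumOf (λ x → f x ℚ.+ g x) xs ≡ sumOf f xs ℚ.+ sumOf g xs
    sum-+ f g [] = refl
    sum-+ f g (x ∷ xs) rewrite sum-+ f g xs =
      solve 4 (λ a b c d → (a :+ b) :+ (c :+ d) := (a :+ c) :+ (b :+ d)) refl (f x) (g x) (sumOf f xs) (sumOf g xs)

    sum-scale : ∀ (w : ℚ) (f : A → ℚ) xs → sumOf (λ x → w ℚ.* f x) xs ≡ w ℚ.* sumOf f xs
    sum-scale w f [] = sym (ℚP.*-zeroʳ w)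
    sum-scale w f (x ∷ xs) = trans (cong (w ℚ.* f x ℚ.+_) (sum-scale w f xs)) (sym (ℚP.*-distribˡ-+ w (f x) _))

    sum-map : ∀ {B : Set} (f : B → ℚ) (g : A → B) xs → sumOf f (map g xs) ≡ sumOf (f ∘ g) xs
    sum-map f g xs = cong sumℚ (sym (map-∘ xs))
      where open import Data.List.Properties using (map-∘)

    sum-cong : ∀ (f g : A → ℚ) xs → (∀ x → x ∈ xs → f x ≡ g x) → sumOf f xs ≡ sumOf g xs
    sum-cong f g [] h = refl
    sum-cong f g (x ∷ xs) h = cong₂ ℚ._+_ (h x (here refl)) (sum-cong f g xs (λ y m → h y (there m)))

    sum-bound : ∀ (f : A → ℚ) (b : ℚ) xs → (∀ x → x ∈ xs → f x ℚ.≤ b) → sumOf f xs ℚ.≤ ℕtoℚ (length xs) ℚ.* b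
    sum-bound f b [] h = ℚP.≤-reflexive (sym (ℚP.*-zeroˡ b))
    sum-bound f b (x ∷ xs) h =
      ℚP.≤-trans (ℚP.+-mono-≤ (h x (here refl)) (sum-bound f b xs (λ y m → h y (there m))))
                 (ℚP.≤-reflexive (sym (suc-* (length xs) b)))

    sum-const : ∀ (w : ℚ) xs → sumOf (λ (_ : A) → w) xs ≡ ℕtoℚ (length xs) ℚ.* w
    sum-const w [] = sym (ℚP.*-zeroˡ w)
    sum-const w (x ∷ xs) = trans (cong (w ℚ.+_) (sum-const w xs)) (sym (suc-* (length xs) w))

  module _ {A : Set} {P : Pred A 0ℓ} (P? : Decidable P) where

    length-filter-split : ∀ xs → length (filter P? xs) ℕ.+ length (filter (¬? ∘ P?) xs) ≡ length xs
    length-filter-split [] = refl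
    length-filter-split (x ∷ xs) with does (P? x)
    ... | true = cong suc (length-filter-split xs)
    ... | false = trans (ℕP.+-suc _ _) (cong suc (length-filter-split xs))

    sum-filter-split : ∀ (f : A → ℚ) xs → sumOf f xs ≡ sumOf f (filter P? xs) ℚ.+ sumOf f (filter (¬? ∘ P?) xs)
    sum-filter-split f [] = sym (ℚP.+-identityˡ 0ℚ)
    sum-filter-split f (x ∷ xs) with does (P? x)
    ... | true = trans (cong (f x ℚ.+_) (sum-filter-split f xs)) (sym (ℚP.+-assoc (f x) _ _))
    ... | false rewrite sum-filter-split f xs =
      solve 3 (λ a b c → a :+ (b :+ c) := b :+ (a :+ c)) refl (f x) (sumOf f (filter P? xs)) (sumOf f (filter (¬? ∘ P?) xs))

  map-nonempty : ∀ {A B : Set} (f : A → B) {x : A} {xs} → x ∈ xs → ¬ map f xs ≡ []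
  map-nonempty f (here _) ()
  map-nonempty f (there _) ()

  average-bound : ∀ {A : Set} (m : ℕ) (L : List A) (f g : A → ℚ) (b y : ℚ) → length L ≡ suc m →
                  (∀ x → x ∈ L → g x ℚ.≤ b) → sumOf f L ℚ.≤ ℕtoℚ (suc m) ℚ.* y →
                  sumOf (λ x → inv (suc m) ℚ.* (g x ℚ.+ f x)) L ℚ.≤ b ℚ.+ y
  average-bound m L f g b y eL hg hf =
    begin
      sumOf (λ x → w ℚ.* (g x ℚ.+ f x)) L
    ≡⟨ trans (sum-scale w (λ x → g x ℚ.+ f x) L) (cong (w ℚ.*_) (sum-+ g f L)) ⟩
      w ℚ.* (sumOf g L ℚ.+ sumOf f L)
    ≤⟨ *-monoˡ-0≤ (0≤inv (suc m)) (ℚP.+-mono-≤ (ℚP.≤-trans (sum-bound g b L hg) (ℚP.≤-reflexive (cong (λ z → ℕtoℚ z ℚ.* b) eL))) hf) ⟩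
      w ℚ.* (M ℚ.* b ℚ.+ M ℚ.* y)
    ≡⟨ solve 4 (λ w M a b → w :* (M :* a :+ M :* b) := (M :* w) :* (a :+ b)) refl w M b y ⟩
      (M ℚ.* w) ℚ.* (b ℚ.+ y)
    ≡⟨ trans (cong (ℚ._* (b ℚ.+ y)) (inv-inverse m)) (ℚP.*-identityˡ _) ⟩
      b ℚ.+ y
    ∎
    where
    open ℚP.≤-Reasoning
    w = inv (suc m)
    M = ℕtoℚ (suc m)

-- The potential function of
-- the analysis charges H(number of candidate subspaces); we need that H is
-- monotone, that shrinking the candidate set from m'+t to m' releases at
-- least t/(m'+t), and that H(2^a) ≤ a + 1.
module Harmonic where

  open Embedding
  open import Data.Rational.Solver using (module +-*-Solver)
  open +-*-Solver

  H : ℕ → ℚ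
  H zero = 0ℚ
  H (suc m) = H m ℚ.+ inv (suc m)

  0≤H : ∀ m → 0ℚ ℚ.≤ H m
  0≤H zero = ℚP.≤-refl
  0≤H (suc m) = 0≤+ (0≤H m) (0≤inv (suc m))

  H-mono : ∀ {a b} → a ℕ.≤ b → H a ℚ.≤ H b
  H-mono {a} {b} le with ℕP.≤⇒≤′ le
  ... | ℕ.≤′-refl = ℚP.≤-refl
  ... | ℕ.≤′-step {n = b'} le' =
    ℚP.≤-trans (H-mono (ℕP.≤′⇒≤ le')) (ℚP.≤-trans (ℚP.≤-reflexive (sym (ℚP.+-identityʳ (H b')))) (ℚP.+-monoʳ-≤ (H b') (0≤inv (suc b'))))

  -- H (m + t) - H m ≥ t / (m + t), in multiplied-out form
  harmonic-gain : ∀ m t → ℕtoℚ (m ℕ.+ t) ℚ.* H m ℚ.+ ℕtoℚ t ℚ.≤ ℕtoℚ (m ℕ.+ t) ℚ.* H (m ℕ.+ t)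
  harmonic-gain m zero rewrite ℕP.+-identityʳ m = ℚP.≤-reflexive (ℚP.+-identityʳ _)
  harmonic-gain m (suc t) rewrite ℕP.+-suc m t =
    begin
      ℕtoℚ (suc M) ℚ.* x ℚ.+ ℕtoℚ (suc t)
    ≡⟨ cong₂ (λ u v → u ℚ.* x ℚ.+ v) (ℕtoℚ-+ 1 M) (ℕtoℚ-+ 1 t) ⟩
      (1ℚ ℚ.+ a) ℚ.* x ℚ.+ (1ℚ ℚ.+ tq)
    ≡⟨ solve 3 (λ a x tq → (con 1ℚ :+ a) :* x :+ (con 1ℚ :+ tq) := (a :* x :+ tq) :+ x :+ con 1ℚ) refl a x tq ⟩
      (a ℚ.* x ℚ.+ tq) ℚ.+ x ℚ.+ 1ℚ
    ≤⟨ ℚP.+-monoˡ-≤ 1ℚ (ℚP.+-mono-≤ (harmonic-gain m t) (H-mono (ℕP.m≤m+n m t))) ⟩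
      a ℚ.* z ℚ.+ z ℚ.+ 1ℚ
    ≡⟨ cong (a ℚ.* z ℚ.+ z ℚ.+_) (sym (trans (cong (ℚ._* w) (sym (ℕtoℚ-+ 1 M))) (inv-inverse M))) ⟩
      a ℚ.* z ℚ.+ z ℚ.+ (1ℚ ℚ.+ a) ℚ.* w
    ≡⟨ solve 3 (λ a z w → a :* z :+ z :+ (con 1ℚ :+ a) :* w := (con 1ℚ :+ a) :* (z :+ w)) refl a z w ⟩
      (1ℚ ℚ.+ a) ℚ.* (z ℚ.+ w)
    ≡⟨ cong (ℚ._* (z ℚ.+ w)) (sym (ℕtoℚ-+ 1 M)) ⟩
      ℕtoℚ (suc M) ℚ.* H (suc M)
    ∎
    where
    open ℚP.≤-Reasoning
    M = m ℕ.+ t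
    a = ℕtoℚ M
    x = H m
    z = H M
    w = inv (suc M)
    tq = ℕtoℚ t

  -- each of the terms 1/(m+1), ..., 1/(m+j) is at most 1/(m+1)
  H-add : ∀ m j → H (m ℕ.+ j) ℚ.≤ H m ℚ.+ ℕtoℚ j ℚ.* inv (suc m)
  H-add m zero rewrite ℕP.+-identityʳ m = ℚP.≤-reflexive (sym (trans (cong (H m ℚ.+_) (ℚP.*-zeroˡ (inv (suc m)))) (ℚP.+-identityʳ (H m))))
  H-add m (suc j) rewrite ℕP.+-suc m j =
    begin
      H (m ℕ.+ j) ℚ.+ inv (suc (m ℕ.+ j))
    ≤⟨ ℚP.+-mono-≤ (H-add m j) (inv-antitone (ℕP.m≤m+n m j)) ⟩
      H m ℚ.+ ℕtoℚ j ℚ.* w ℚ.+ w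
    ≡⟨ solve 3 (λ h j w → h :+ j :* w :+ w := h :+ (con 1ℚ :+ j) :* w) refl (H m) (ℕtoℚ j) w ⟩
      H m ℚ.+ (1ℚ ℚ.+ ℕtoℚ j) ℚ.* w
    ≡⟨ cong (λ z → H m ℚ.+ z ℚ.* w) (sym (ℕtoℚ-+ 1 j)) ⟩
      H m ℚ.+ ℕtoℚ (suc j) ℚ.* w
    ∎
    where
    open ℚP.≤-Reasoning
    w = inv (suc m)

  H-double : ∀ m → H (m ℕ.+ m) ℚ.≤ H m ℚ.+ 1ℚ
  H-double m = ℚP.≤-trans (H-add m m) (ℚP.+-monoʳ-≤ (H m)
    (ℚP.≤-trans (*-monoʳ-0≤ (0≤inv (suc m)) (ℕtoℚ-mono (ℕP.n≤1+n m))) (ℚP.≤-reflexive (inv-inverse m))))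

  H-pow2 : ∀ a → H (2 ℕ.^ a) ℚ.≤ ℕtoℚ (suc a)
  H-pow2 zero = ℚP.≤-reflexive (ℚP.+-identityˡ 1ℚ)
  H-pow2 (suc a) =
    begin
      H (2 ℕ.^ a ℕ.+ (2 ℕ.^ a ℕ.+ 0))
    ≡⟨ cong (λ z → H (2 ℕ.^ a ℕ.+ z)) (ℕP.+-identityʳ (2 ℕ.^ a)) ⟩
      H (2 ℕ.^ a ℕ.+ 2 ℕ.^ a)
    ≤⟨ H-double (2 ℕ.^ a) ⟩
      H (2 ℕ.^ a) ℚ.+ 1ℚ
    ≤⟨ ℚP.+-monoˡ-≤ 1ℚ (H-pow2 a) ⟩
      ℕtoℚ (suc a) ℚ.+ 1ℚ
    ≡⟨ trans (ℚP.+-comm (ℕtoℚ (suc a)) 1ℚ) (sym (ℕtoℚ-+ 1 (suc a))) ⟩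
      ℕtoℚ (suc (suc a))
    ∎
    where open ℚP.≤-Reasoning

module Distance {k : ℕ} {n : Fin k → ℕ} where

  open import Data.Fin.Properties using (¬∀⟶∃¬)
  open import Data.List.Membership.Propositional.Properties using (∈-allFin)
  open import Data.List.Properties using (length-tabulate)
  open import Data.Nat.ListAction using (sum)
  open import Relation.Nullary using (does; yes; no; ¬_)

  private
    mismatch : Config k n → Config k n → Fin k → ℕ
    mismatch c c' i = if does (c i ≟ c' i) then 0 else 1

    sum-mismatch-≤ : ∀ c c' (is : List (Fin k)) → sum (map (mismatch c c') is) ℕ.≤ length is
    sum-mismatch-≤ c c' [] = ℕ.z≤n
    sum-mismatch-≤ c c' (i ∷ is) with does (c i ≟ c' i)
    ... | true = ℕP.m≤n⇒m≤1+n (sum-mismatch-≤ c c' is)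
    ... | false = ℕ.s≤s (sum-mismatch-≤ c c' is)

    sum-mismatch-self : ∀ c (is : List (Fin k)) → sum (map (mismatch c c) is) ≡ 0
    sum-mismatch-self c [] = refl
    sum-mismatch-self c (i ∷ is) with c i ≟ c i
    ... | yes _ = sum-mismatch-self c is
    ... | no c≢c = ⊥-elim (c≢c refl)

    sum-mismatch-pos : ∀ c c' {i} (is : List (Fin k)) → i ∈ is → ¬ c i ≡ c' i → 1 ℕ.≤ sum (map (mismatch c c') is)
    sum-mismatch-pos c c' {i} (i ∷ is) (here refl) ne with c i ≟ c' i
    ... | yes eq = ⊥-elim (ne eq)
    ... | no _ = ℕ.s≤s ℕ.z≤n
    sum-mismatch-pos c c' (j ∷ is) (there m) ne =
      ℕP.≤-trans (sum-mismatch-pos c c' is m ne) (ℕP.m≤n+m _ (mismatch c c' j))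

  dist≤k : ∀ c c' → dist c c' ℕ.≤ k
  dist≤k c c' = ℕP.≤-trans (sum-mismatch-≤ c c' (allFin k)) (ℕP.≤-reflexive (length-tabulate {n = k} (λ i → i)))

  dist-self : ∀ c → dist c c ≡ 0
  dist-self c = sum-mismatch-self c (allFin k)

  dist-pos : ∀ c c' → ¬ (∀ i → c i ≡ c' i) → 1 ℕ.≤ dist c c'
  dist-pos c c' ne with ¬∀⟶∃¬ k (λ i → c i ≡ c' i) (λ i → c i ≟ c' i) ne
  ... | i , ci≢c'i = sum-mismatch-pos c c' (allFin k) (∈-allFin i) ci≢c'i

module PartialAssignments where

  open import Data.Maybe using (Maybe; just; nothing)
  import Data.Fin as Fin
  open import Relation.Nullary using (does; yes; no)

  freeCount : ∀ {m} {A : Fin m → Set} → ((i : Fin m) → Maybe (A i)) → ℕ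
  freeCount {zero} Q = 0
  freeCount {suc m} Q = isFree (Q Fin.zero) ℕ.+ freeCount (λ i → Q (Fin.suc i))
    where
    isFree : ∀ {B : Set} → Maybe B → ℕ
    isFree nothing = 1
    isFree (just _) = 0

  fixAt : ∀ {m} {A : Fin m → Set} → ((i : Fin m) → A i) → ((i : Fin m) → Maybe (A i)) → Fin m → (i : Fin m) → Maybe (A i)
  fixAt r Q i j = if does (j ≟ i) then just (r j) else Q j

  fixAt-self : ∀ {m} {A : Fin m → Set} (r : (i : Fin m) → A i) Q i → fixAt {A = A} r Q i i ≡ just (r i)
  fixAt-self r Q i with i ≟ i
  ... | yes _ = refl
  ... | no i≢i = ⊥-elim (i≢i refl)

  freeCount≤ : ∀ {m} {A : Fin m → Set} (Q : (i : Fin m) → Maybe (A i)) → freeCount Q ℕ.≤ m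
  freeCount≤ {zero} Q = ℕ.z≤n
  freeCount≤ {suc m} Q with Q Fin.zero
  ... | nothing = ℕ.s≤s (freeCount≤ (λ i → Q (Fin.suc i)))
  ... | just _ = ℕP.m≤n⇒m≤1+n (freeCount≤ (λ i → Q (Fin.suc i)))

  freeCount-nothing : ∀ m {A : Fin m → Set} → freeCount {m} {A} (λ _ → nothing) ≡ m
  freeCount-nothing zero = refl
  freeCount-nothing (suc m) = cong suc (freeCount-nothing m)

  freeCount-fixAt : ∀ {m} {A : Fin m → Set} (r : (i : Fin m) → A i) Q i → Q i ≡ nothing →
                    suc (freeCount (fixAt {A = A} r Q i)) ≡ freeCount Q
  freeCount-fixAt {suc m} r Q Fin.zero Qi≡nothing rewrite Qi≡nothing = refl
  freeCount-fixAt {suc m} r Q (Fin.suc i) Qi≡nothing with Q Fin.zero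
  ... | nothing = cong suc (freeCount-fixAt (λ j → r (Fin.suc j)) (λ j → Q (Fin.suc j)) i Qi≡nothing)
  ... | just _ = freeCount-fixAt (λ j → r (Fin.suc j)) (λ j → Q (Fin.suc j)) i Qi≡nothing

-- A subspace of the
-- configuration space fixes some servers to points and leaves the others
-- free; the algorithm maintains a list of subspaces, all of whose points
-- serve every request seen since the last restart.
module Subspaces (k' : ℕ) (n : Fin (suc k') → ℕ) (c₀ : Config (suc k') n) where

  open PartialAssignments
  open import Data.Maybe using (Maybe; just; nothing)
  open import Data.Maybe.Properties using (≡-dec)
  import Data.Fin as Fin
  open import Data.Fin.Properties using (all?) renaming (any? to anyFin?)
  open import Data.List using (concatMap; filter)
  open import Data.List.Properties using (filter-++; filter-none; filter-all; length-filter; length-tabulate; map-++)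
  open import Data.List.Membership.Propositional using (find; lose)
  open import Data.List.Membership.Propositional.Properties
    using (∈-map⁺; ∈-map⁻; ∈-allFin; ∈-filter⁺; ∈-filter⁻; ∈-concatMap⁺; ∈-concatMap⁻)
  open import Data.List.Relation.Unary.All using (All) renaming (lookup to All-lookup; tabulate to All-tabulate)
  open import Data.List.Relation.Unary.All.Properties using () renaming (map⁺ to All-map⁺)
  open import Data.List.Extrema ℕP.≤-totalOrder using (max; xs≤max; max≤v⁺; argmax-sel)
  open import Relation.Nullary using (Dec; yes; no; ¬_)
  open import Data.Nat.ListAction using (sum)
  open import Data.Nat.ListAction.Properties using (sum-++)

  k : ℕ
  k = suc k'

  Cfg : Set
  Cfg = Config k n

  -- a subspace fixes some servers (just v) and leaves the others free
  Subspace : Set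
  Subspace = (i : Fin k) → Maybe (Fin (n i))

  whole : Subspace
  whole _ = nothing

  dim : Subspace → ℕ
  dim = freeCount

  -- every point of Q serves r: some fixed coordinate of Q agrees with r
  Survives : Cfg → Subspace → Set
  Survives r Q = Σ (Fin k) λ i → Q i ≡ just (r i)

  survives? : ∀ r Q → Dec (Survives r Q)
  survives? r Q = anyFin? (λ i → ≡-dec _≟_ (Q i) (just (r i)))

  freeCoords : Subspace → List (Fin k)
  freeCoords Q = filter (λ i → ≡-dec _≟_ (Q i) nothing) (allFin k)

  ∈-freeCoords : ∀ {Q i} → i ∈ freeCoords Q → Q i ≡ nothing
  ∈-freeCoords {Q} m = proj₂ (∈-filter⁻ (λ i → ≡-dec _≟_ (Q i) nothing) m)

  freeCoords-∈ : ∀ {Q} i → Q i ≡ nothing → i ∈ freeCoords Q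
  freeCoords-∈ {Q} i e = ∈-filter⁺ (λ i → ≡-dec _≟_ (Q i) nothing) (∈-allFin i) e

  child : Cfg → Subspace → Fin k → Subspace
  child = fixAt

  refine : Cfg → Subspace → List Subspace
  refine r Q with survives? r Q
  ... | yes _ = [ Q ]
  ... | no _ = map (child r Q) (freeCoords Q)

  refineAll : List Subspace → Cfg → List Subspace
  refineAll F r = concatMap (refine r) F

  restartIfEmpty : Cfg → List Subspace → List Subspace
  restartIfEmpty r [] = refine r whole
  restartIfEmpty r (Q ∷ F) = Q ∷ F

  step : List Subspace → Cfg → List Subspace
  step F r = restartIfEmpty r (refineAll F r)

  restartCost : List Subspace → ℕ
  restartCost [] = 1
  restartCost (_ ∷ _) = 0

  resets : List Subspace → List Cfg → ℕ
  resets F [] = 0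
  resets F (r ∷ σ) = restartCost (refineAll F r) ℕ.+ resets (step F r) σ

  ∈-refine : ∀ {Q Q'} r → Q' ∈ refine r Q →
             (Q' ≡ Q × Survives r Q) ⊎ (Σ (Fin k) λ i → Q i ≡ nothing × Q' ≡ child r Q i × ¬ Survives r Q)
  ∈-refine {Q} r m with survives? r Q
  ∈-refine r (here refl) | yes s = inj₁ (refl , s)
  ... | no ns with ∈-map⁻ (child r Q) m
  ...   | i , mi , e = inj₂ (i , ∈-freeCoords {Q} mi , e , ns)

  refine-survives : ∀ {Q Q'} r → Q' ∈ refine r Q → Survives r Q'
  refine-survives {Q} r m with ∈-refine {Q} r m
  ... | inj₁ (refl , s) = s
  ... | inj₂ (i , _ , refl , _) = i , fixAt-self r Q i

  ∈-refineAll : ∀ {Q'} F r → Q' ∈ refineAll F r → Σ Subspace λ Q → Q ∈ F × Q' ∈ refine r Q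
  ∈-refineAll F r m = find (∈-concatMap⁻ (refine r) m)

  refineAll-∈ : ∀ {Q Q'} F r → Q ∈ F → Q' ∈ refine r Q → Q' ∈ refineAll F r
  refineAll-∈ F r mQ m = ∈-concatMap⁺ (refine r) (lose mQ m)

  ∈-step : ∀ {Q'} F r → Q' ∈ step F r → Σ Subspace λ Q → Q' ∈ refine r Q
  ∈-step {Q'} F r m with refineAll F r in e
  ... | [] = whole , m
  ... | _ ∷ _ with ∈-refineAll F r (subst (Q' ∈_) (sym e) m)
  ...   | Q , _ , m' = Q , m'

  step-survives : ∀ {Q'} F r → Q' ∈ step F r → Survives r Q'
  step-survives F r m with ∈-step F r m
  ... | Q , m' = refine-survives {Q} r m'

  dim-whole : dim whole ≡ k
  dim-whole = freeCount-nothing k {λ i → Fin (n i)}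

  dim≤k : ∀ Q → dim Q ℕ.≤ k
  dim≤k = freeCount≤

  dim-child : ∀ r Q i → Q i ≡ nothing → suc (dim (child r Q i)) ≡ dim Q
  dim-child = freeCount-fixAt

  refine-dim : ∀ {Q Q'} r → Q' ∈ refine r Q → (Q' ≡ Q × Survives r Q) ⊎ (suc (dim Q') ≡ dim Q × ¬ Survives r Q)
  refine-dim {Q} r m with ∈-refine {Q} r m
  ... | inj₁ same = inj₁ same
  ... | inj₂ (i , free , refl , ns) = inj₂ (dim-child r Q i free , ns)

  -- the maximal dimension of a family (0 for the empty family)
  maxDim : List Subspace → ℕ
  maxDim F = max 0 (map dim F)

  maxDim-≥ : ∀ {Q} F → Q ∈ F → dim Q ℕ.≤ maxDim F
  maxDim-≥ F m = All-lookup (xs≤max 0 (map dim F)) (∈-map⁺ dim m)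

  maxDim-≤ : ∀ F d → (∀ Q → Q ∈ F → dim Q ℕ.≤ d) → maxDim F ℕ.≤ d
  maxDim-≤ F d h = max≤v⁺ ℕ.z≤n (All-map⁺ (All-tabulate (λ {Q} m → h Q m)))

  maxDim-attained : ∀ {Q} F → Q ∈ F → Σ Subspace λ Q' → Q' ∈ F × dim Q' ≡ maxDim F
  maxDim-attained {Q} F m with argmax-sel id 0 (map dim F)
  ... | inj₁ max≡0 = Q , m , ℕP.≤-antisym (maxDim-≥ F m) (ℕP.≤-trans (ℕP.≤-reflexive max≡0) ℕ.z≤n)
  ... | inj₂ max∈ with ∈-map⁻ dim max∈
  ...   | Q' , m' , e = Q' , m' , sym e

  layerAt : ℕ → List Subspace → List Subspace
  layerAt d F = filter (λ Q → dim Q ℕ.≟ d) F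

  layer : List Subspace → List Subspace
  layer F = layerAt (maxDim F) F

  ∈-layer : ∀ {Q} F → Q ∈ layer F → Q ∈ F × dim Q ≡ maxDim F
  ∈-layer F m = ∈-filter⁻ (λ Q → dim Q ℕ.≟ maxDim F) m

  layer-∈ : ∀ {Q} F → Q ∈ F → dim Q ≡ maxDim F → Q ∈ layer F
  layer-∈ F m e = ∈-filter⁺ (λ Q → dim Q ℕ.≟ maxDim F) m e

  maxDim-refineAll : ∀ F r → maxDim (refineAll F r) ℕ.≤ maxDim F
  maxDim-refineAll F r = maxDim-≤ (refineAll F r) (maxDim F) bound
    where
    bound : ∀ Q' → Q' ∈ refineAll F r → dim Q' ℕ.≤ maxDim F
    bound Q' m with ∈-refineAll F r m
    ... | Q , mQ , m' with refine-dim {Q} r m'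
    ...   | inj₁ (refl , _) = maxDim-≥ F mQ
    ...   | inj₂ (lower , _) = ℕP.≤-trans (ℕP.n≤1+n _) (ℕP.≤-trans (ℕP.≤-reflexive lower) (maxDim-≥ F mQ))

  private
    layerAt-children : ∀ d r Q → dim Q ℕ.≤ d → layerAt d (map (child r Q) (freeCoords Q)) ≡ []
    layerAt-children d r Q le = filter-none (λ Q' → dim Q' ℕ.≟ d) (All-tabulate below)
      where
      below : ∀ {Q'} → Q' ∈ map (child r Q) (freeCoords Q) → ¬ dim Q' ≡ d
      below m dimQ'≡d with ∈-map⁻ (child r Q) m
      ... | i , mi , refl = ℕP.<-irrefl refl (ℕP.≤-trans (ℕP.≤-reflexive (dim-child r Q i (∈-freeCoords {Q} mi)))
                                             (ℕP.≤-trans le (ℕP.≤-reflexive (sym dimQ'≡d))))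

    layerAt-singleton : ∀ d Q {P : Subspace → Set} → P Q → All P (layerAt d [ Q ])
    layerAt-singleton d Q {P} PQ = All-tabulate only-Q
      where
      only-Q : ∀ {Q'} → Q' ∈ layerAt d [ Q ] → P Q'
      only-Q m with ∈-filter⁻ (λ Q' → dim Q' ℕ.≟ d) {xs = [ Q ]} m
      ... | here refl , _ = PQ

    layerAt-refine : ∀ d r Q → dim Q ℕ.≤ d → layerAt d (refine r Q) ≡ filter (survives? r) (layerAt d [ Q ])
    layerAt-refine d r Q le with survives? r Q
    ... | yes s = sym (filter-all (survives? r) (layerAt-singleton d Q s))
    ... | no ns = trans (layerAt-children d r Q le) (sym (filter-none (survives? r) (layerAt-singleton d Q ns)))

  layerAt-refineAll : ∀ d F r → (∀ Q → Q ∈ F → dim Q ℕ.≤ d) →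
                      layerAt d (refineAll F r) ≡ filter (survives? r) (layerAt d F)
  layerAt-refineAll d [] r h = refl
  layerAt-refineAll d (Q ∷ F) r h =
    begin
      layerAt d (refine r Q ++ refineAll F r)
    ≡⟨ filter-++ dim≟d (refine r Q) (refineAll F r) ⟩
      layerAt d (refine r Q) ++ layerAt d (refineAll F r)
    ≡⟨ cong₂ _++_ (layerAt-refine d r Q (h Q (here refl))) (layerAt-refineAll d F r (λ Q' m → h Q' (there m))) ⟩
      filter (survives? r) (layerAt d [ Q ]) ++ filter (survives? r) (layerAt d F)
    ≡⟨ sym (filter-++ (survives? r) (layerAt d [ Q ]) (layerAt d F)) ⟩
      filter (survives? r) (layerAt d [ Q ] ++ layerAt d F)
    ≡⟨ cong (filter (survives? r)) (sym (filter-++ dim≟d [ Q ] F)) ⟩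
      filter (survives? r) (layerAt d (Q ∷ F))
    ∎
    where
    open ≡-Reasoning
    dim≟d : ∀ Q → Dec (dim Q ≡ d)
    dim≟d Q = dim Q ℕ.≟ d

  layer-refineAll : ∀ F r → maxDim (refineAll F r) ≡ maxDim F → layer (refineAll F r) ≡ filter (survives? r) (layer F)
  layer-refineAll F r e =
    trans (cong (λ d → layerAt d (refineAll F r)) e) (layerAt-refineAll (maxDim F) F r (λ Q m → maxDim-≥ F m))

  step-cases : ∀ F r → (restartCost (refineAll F r) ≡ 1) ⊎ (restartCost (refineAll F r) ≡ 0 × step F r ≡ refineAll F r)
  step-cases F r with refineAll F r
  ... | [] = inj₁ refl
  ... | _ ∷ _ = inj₂ (refl , refl)

  -- The weight of a family, Σ k^dim Q, never increases under refinement: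
  -- a dead subspace of dimension d is replaced by at most k children of
  -- dimension d - 1.  Starting from a single (k-1)-dimensional layer the
  -- family therefore never has more than k^k members.
  weight : List Subspace → ℕ
  weight F = sum (map (λ Q → k ℕ.^ dim Q) F)

  weight-++ : ∀ F G → weight (F ++ G) ≡ weight F ℕ.+ weight G
  weight-++ F G = trans (cong sum (map-++ (λ Q → k ℕ.^ dim Q) F G)) (sum-++ (map (λ Q → k ℕ.^ dim Q) F) _)

  weight-children : ∀ r Q (L : List (Fin k)) → (∀ i → i ∈ L → Q i ≡ nothing) →
                    weight (map (child r Q) L) ℕ.* k ≡ length L ℕ.* k ℕ.^ dim Q
  weight-children r Q [] h = refl
  weight-children r Q (i ∷ L) h =
    begin
      (k ℕ.^ dim (child r Q i) ℕ.+ weight (map (child r Q) L)) ℕ.* k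
    ≡⟨ ℕP.*-distribʳ-+ k (k ℕ.^ dim (child r Q i)) (weight (map (child r Q) L)) ⟩
      k ℕ.^ dim (child r Q i) ℕ.* k ℕ.+ weight (map (child r Q) L) ℕ.* k
    ≡⟨ cong₂ ℕ._+_ (trans (ℕP.*-comm _ k) (cong (k ℕ.^_) (dim-child r Q i (h i (here refl)))))
                   (weight-children r Q L (λ j m → h j (there m))) ⟩
      k ℕ.^ dim Q ℕ.+ length L ℕ.* k ℕ.^ dim Q
    ∎
    where open ≡-Reasoning

  length-freeCoords : ∀ Q → length (freeCoords Q) ℕ.≤ k
  length-freeCoords Q = ℕP.≤-trans (length-filter (λ i → ≡-dec _≟_ (Q i) nothing) (allFin k))
                                  (ℕP.≤-reflexive (length-tabulate {n = k} id))

  weight-refine : ∀ r Q → weight (refine r Q) ℕ.≤ k ℕ.^ dim Q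
  weight-refine r Q with survives? r Q
  ... | yes _ = ℕP.≤-reflexive (ℕP.+-identityʳ _)
  ... | no _ = ℕP.*-cancelʳ-≤ _ _ k (begin
      weight (map (child r Q) (freeCoords Q)) ℕ.* k
    ≡⟨ weight-children r Q (freeCoords Q) (λ i m → ∈-freeCoords {Q} m) ⟩
      length (freeCoords Q) ℕ.* k ℕ.^ dim Q
    ≤⟨ ℕP.*-monoˡ-≤ (k ℕ.^ dim Q) (length-freeCoords Q) ⟩
      k ℕ.* k ℕ.^ dim Q
    ≡⟨ ℕP.*-comm k _ ⟩
      k ℕ.^ dim Q ℕ.* k
    ∎)
    where open ℕP.≤-Reasoning

  weight-refineAll : ∀ F r → weight (refineAll F r) ℕ.≤ weight F
  weight-refineAll [] r = ℕ.z≤n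
  weight-refineAll (Q ∷ F) r =
    ℕP.≤-trans (ℕP.≤-reflexive (weight-++ (refine r Q) (refineAll F r))) (ℕP.+-mono-≤ (weight-refine r Q) (weight-refineAll F r))

  weight-step : ∀ F r → weight F ℕ.≤ k ℕ.^ k → weight (step F r) ℕ.≤ k ℕ.^ k
  weight-step F r h with refineAll F r | weight-refineAll F r
  ... | [] | _ = ℕP.≤-trans (weight-refine r whole) (ℕP.≤-reflexive (cong (k ℕ.^_) dim-whole))
  ... | _ ∷ _ | le = ℕP.≤-trans le h

  weight-initial : weight [ whole ] ≡ k ℕ.^ k
  weight-initial = trans (ℕP.+-identityʳ _) (cong (k ℕ.^_) dim-whole)

  length≤weight : ∀ F → length F ℕ.≤ weight F
  length≤weight [] = ℕ.z≤n
  length≤weight (Q ∷ F) = ℕP.+-mono-≤ (ℕP.m^n>0 k (dim Q)) (length≤weight F)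

  length-layer : ∀ F → weight F ℕ.≤ k ℕ.^ k → length (layer F) ℕ.≤ k ℕ.^ k
  length-layer F h = ℕP.≤-trans (length-filter (λ Q → dim Q ℕ.≟ maxDim F) F) (ℕP.≤-trans (length≤weight F) h)

  refine-whole-nonempty : ∀ r → Σ Subspace (_∈ refine r whole)
  refine-whole-nonempty r with survives? r whole
  ... | yes _ = whole , here refl
  ... | no _ = child r whole Fin.zero , ∈-map⁺ (child r whole) (freeCoords-∈ {whole} Fin.zero refl)

  step-nonempty : ∀ F r → Σ Subspace (_∈ step F r)
  step-nonempty F r with refineAll F r
  ... | [] = refine-whole-nonempty r
  ... | Q ∷ _ = Q , here refl

  layer-nonempty : ∀ F → Σ Subspace (_∈ F) → Σ Subspace (_∈ layer F)
  layer-nonempty F (Q , m) with maxDim-attained F m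
  ... | Q' , m' , e = Q' , layer-∈ F m' e

  -- Lower bound on the optimum: while the adversary sits at a point y of
  -- some subspace of the family, y serves every request and stays inside
  -- the refined family, so the family cannot die out.  Hence every phase
  -- after the first forces the adversary to move.
  _∈ₛ_ : Cfg → Subspace → Set
  y ∈ₛ Q = ∀ i v → Q i ≡ just v → y i ≡ v

  Covers : List Subspace → Cfg → Set
  Covers F y = Σ Subspace λ Q → Q ∈ F × y ∈ₛ Q

  refine-covers : ∀ r Q y → y ∈ₛ Q → Serves r y → Σ Subspace λ Q' → Q' ∈ refine r Q × y ∈ₛ Q'
  refine-covers r Q y y∈Q (i , yi≡ri) with survives? r Q
  ... | yes _ = Q , here refl , y∈Q
  ... | no ns with Q i in Qi
  ...   | just v = ⊥-elim (ns (i , trans Qi (cong just (trans (sym (y∈Q i v Qi)) yi≡ri))))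
  ...   | nothing = child r Q i , ∈-map⁺ (child r Q) (freeCoords-∈ {Q} i Qi) , y∈child
    where
    y∈child : y ∈ₛ child r Q i
    y∈child j v e with j ≟ i
    y∈child j v refl | yes refl = yi≡ri
    ... | no _ = y∈Q j v e

  refineAll-covers : ∀ F r y → Covers F y → Serves r y → Covers (refineAll F r) y
  refineAll-covers F r y (Q , m , y∈Q) s with refine-covers r Q y y∈Q s
  ... | Q' , m' , y∈Q' = Q' , refineAll-∈ F r m m' , y∈Q'

  whole-covers : ∀ r y → Serves r y → Covers (refine r whole) y
  whole-covers r y s = refine-covers r whole y (λ i v ()) s

  covers-transport : ∀ F y c → (∀ i → y i ≡ c i) → Covers F y → Covers F c
  covers-transport F y c y≗c (Q , m , y∈Q) = Q , m , λ i v e → trans (sym (y≗c i)) (y∈Q i v e)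

  serves-transport : ∀ (r y c : Cfg) → (∀ i → y i ≡ c i) → Serves r c → Serves r y
  serves-transport r y c y≗c (i , ci≡ri) = i , trans (y≗c i) ci≡ri

  mutual
    resets-step : ∀ {r c σ τ} → Feasible (r ∷ σ) (c ∷ τ) → ∀ F → resets F (r ∷ σ) ℕ.≤ suc (trajCost c τ)
    resets-step {r} {c} (s ∷ fs) F with refineAll F r
    ... | [] = ℕ.s≤s (resets-covered fs (refine r whole) c (whole-covers r c s))
    ... | Q ∷ G = resets-any fs (Q ∷ G) c

    resets-any : ∀ {σ τ} → Feasible σ τ → ∀ F y → resets F σ ℕ.≤ suc (trajCost y τ)
    resets-any [] F y = ℕ.z≤n
    resets-any {r ∷ σ} {c ∷ τ} fs F y = ℕP.≤-trans (resets-step fs F) (ℕ.s≤s (ℕP.m≤n+m _ (dist y c)))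

    resets-covered : ∀ {σ τ} → Feasible σ τ → ∀ F y → Covers F y → resets F σ ℕ.≤ trajCost y τ
    resets-covered [] F y cov = ℕ.z≤n
    resets-covered {r ∷ σ} {c ∷ τ} fs@(s ∷ fs') F y cov with all? (λ i → y i ≟ c i)
    ... | no y≠c = ℕP.≤-trans (resets-step fs F) (ℕP.+-monoˡ-≤ (trajCost c τ) (dist-pos y c y≠c))
      where open Distance
    ... | yes y≗c with refineAll F r | refineAll-covers F r y cov (serves-transport r y c y≗c s)
    ...   | [] | _ , () , _
    ...   | Q ∷ G | cov' = ℕP.≤-trans (resets-covered fs' (Q ∷ G) c (covers-transport (Q ∷ G) y c y≗c cov'))
                                      (ℕP.m≤n+m _ (dist y c))

module Distributions where

  open Embedding
  open ListSums
  open import Data.List.Relation.Unary.All using (All; []; _∷_)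

  point : ∀ {A : Set} → A → Distr A
  point x = record { support = [ (1ℚ , x) ] ; nonneg = ℚP.≤-trans (0≤ℕtoℚ 0) (ℕtoℚ-mono {0} {1} ℕ.z≤n) ∷ [] ; sums-to-1 = ℚP.+-identityʳ 1ℚ }

  uniform : ∀ {A : Set} → A → List A → Distr A
  uniform {A} x xs = record { support = map (inv m ,_) (x ∷ xs) ; nonneg = nonneg (x ∷ xs) ; sums-to-1 = total }
    where
    m = length (x ∷ xs)
    nonneg : ∀ ys → All (λ p → 0ℚ ℚ.≤ proj₁ p) (map (inv m ,_) ys)
    nonneg [] = []
    nonneg (y ∷ ys) = 0≤inv m ∷ nonneg ys
    weights : ∀ (ys : List A) → sumℚ (map proj₁ (map (inv m ,_) ys)) ≡ sumOf (λ _ → inv m) ys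
    weights [] = refl
    weights (y ∷ ys) = cong (inv m ℚ.+_) (weights ys)
    total : sumℚ (map proj₁ (map (inv m ,_) (x ∷ xs))) ≡ 1ℚ
    total = trans (weights (x ∷ xs)) (trans (sum-const (inv m) (x ∷ xs)) (inv-inverse (length xs)))

  expect : ∀ {A : Set} → List (ℚ × A) → (A → ℚ) → ℚ
  expect [] f = 0ℚ
  expect ((w , x) ∷ L) f = w ℚ.* f x ℚ.+ expect L f

  expect-point : ∀ {A : Set} (x : A) f → expect (Distr.support (point x)) f ≡ f x
  expect-point x f = trans (ℚP.+-identityʳ _) (ℚP.*-identityˡ (f x))

  expect-uniform : ∀ {A : Set} (x : A) xs f →
                   expect (Distr.support (uniform x xs)) f ≡ sumOf (λ y → inv (suc (length xs)) ℚ.* f y) (x ∷ xs)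
  expect-uniform x xs f = go (x ∷ xs)
    where
    go : ∀ ys → expect (map (inv (suc (length xs)) ,_) ys) f ≡ sumOf (λ y → inv (suc (length xs)) ℚ.* f y) ys
    go [] = refl
    go (y ∷ ys) = cong (inv (suc (length xs)) ℚ.* f y ℚ.+_) (go ys)

module Algorithm (k' : ℕ) (n : Fin (suc k') → ℕ) (c₀ : Config (suc k') n) where

  open Subspaces k' n c₀
  open Distributions
  open Embedding
  open ListSums
  open Distance using (dist≤k; dist-self)
  open import Data.Maybe using (fromMaybe)
  import Data.Fin as Fin
  open import Data.Fin.Properties using (all?)
  open import Data.List using (foldl)
  open import Data.List.Properties using (foldl-++; length-map)
  open import Data.List.Membership.Propositional using (mapWith∈; find)
  open import Data.List.Membership.Propositional.Properties using (map-mapWith∈; mapWith∈≗map)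
  open import Data.List.Relation.Unary.Any using (Any; any?)
  open import Relation.Nullary using (Dec; yes; no; ¬_)

  anchor : Subspace → Cfg
  anchor Q i = fromMaybe (c₀ i) (Q i)

  anchor-serves : ∀ {r Q} → Survives r Q → Serves r (anchor Q)
  anchor-serves (i , e) = i , cong (fromMaybe (c₀ i)) e

  IsCandidate : List Subspace → Cfg → Set
  IsCandidate F p = Any (λ Q → ∀ i → p i ≡ anchor Q i) (layer F)

  candidate? : ∀ F p → Dec (IsCandidate F p)
  candidate? F p = any? (λ Q → all? (λ i → p i ≟ anchor Q i)) (layer F)

  candidate-serves : ∀ F r p → IsCandidate (step F r) p → Serves r p
  candidate-serves F r p c with find c
  ... | Q , m , p≗anchor with anchor-serves {r} {Q} (step-survives F r (proj₁ (∈-layer (step F r) m)))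
  ...   | i , e = i , trans (p≗anchor i) e

  ServingCfg : Cfg → Set
  ServingCfg r = Σ Cfg (Serves r)

  targets : List Subspace → (r : Cfg) → List (ServingCfg r)
  targets F r = mapWith∈ (layer (step F r)) (λ {Q} m → anchor Q , anchor-serves (step-survives F r (proj₁ (∈-layer (step F r) m))))

  targets-anchors : ∀ F r → map proj₁ (targets F r) ≡ map anchor (layer (step F r))
  targets-anchors F r = trans (map-mapWith∈ (layer (step F r)) _ proj₁) (mapWith∈≗map anchor (layer (step F r)))

  -- The target
  -- list is never empty (the top layer is non-empty), but the type requires
  -- an answer for that case too, and r itself serves r.
  respond : ∀ F p r → Dec (IsCandidate (step F r) p) → List (ServingCfg r) → Distr (ServingCfg r)
  respond F p r (yes c) _ = point (p , candidate-serves F r p c)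
  respond F p r (no _) [] = point (r , Fin.zero , refl)
  respond F p r (no _) (t ∷ ts) = uniform t ts

  decide : List Subspace → Cfg → (r : Cfg) → Distr (ServingCfg r)
  decide F p r = respond F p r (candidate? (step F r) p) (targets F r)

  -- the algorithm replays the family from its history of requests
  History : Set
  History = List (Cfg × Cfg)

  family : History → List Subspace
  family h = foldl (λ F x → step F (proj₁ x)) [ whole ] h

  position : History → Cfg
  position h = foldl (λ _ x → proj₂ x) c₀ h

  alg : RandAlg k n
  alg h r = decide (family h) (position h) r

  family-snoc : ∀ h r c → family (h ++ [ (r , c) ]) ≡ step (family h) r
  family-snoc h r c = foldl-++ (λ F x → step F (proj₁ x)) [ whole ] h [ (r , c) ]

  position-snoc : ∀ h r c → position (h ++ [ (r , c) ]) ≡ c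
  position-snoc h r c = foldl-++ (λ _ x → proj₂ x) c₀ h [ (r , c) ]

  V : List Subspace → Cfg → List Cfg → ℚ
  V F p [] = 0ℚ
  V F p (r ∷ σ) = expect (Distr.support (decide F p r)) (λ x → ℕtoℚ (dist p (proj₁ x)) ℚ.+ V (step F r) (proj₁ x) σ)

  mutual
    expCost≡V : ∀ σ h → expCost alg h (position h) σ ≡ V (family h) (position h) σ
    expCost≡V [] h = refl
    expCost≡V (r ∷ σ) h = expStep≡expect σ h r (Distr.support (alg h r))

    expStep≡expect : ∀ σ h r L → expStep alg h (position h) r σ L
                     ≡ expect L (λ x → ℕtoℚ (dist (position h) (proj₁ x)) ℚ.+ V (step (family h) r) (proj₁ x) σ)
    expStep≡expect σ h r [] = refl
    expStep≡expect σ h r ((w , (c , s)) ∷ L) =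
      cong₂ (λ a b → w ℚ.* (ℕtoℚ (dist (position h) c) ℚ.+ a) ℚ.+ b) future (expStep≡expect σ h r L)
      where
      h' = h ++ [ (r , c) ]
      future : expCost alg h' c σ ≡ V (step (family h) r) c σ
      future = begin
          expCost alg h' c σ
        ≡⟨ cong (λ x → expCost alg h' x σ) (sym (position-snoc h r c)) ⟩
          expCost alg h' (position h') σ
        ≡⟨ expCost≡V σ h' ⟩
          V (family h') (position h') σ
        ≡⟨ cong₂ (λ F x → V F x σ) (family-snoc h r c) (position-snoc h r c) ⟩
          V (step (family h) r) c σ
        ∎
        where open ≡-Reasoning

  V-stay : ∀ F p r σ → IsCandidate (step F r) p → V F p (r ∷ σ) ≡ V (step F r) p σ
  V-stay F p r σ c = stay (candidate? (step F r) p) (targets F r)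
    where
    h : ServingCfg r → ℚ
    h x = ℕtoℚ (dist p (proj₁ x)) ℚ.+ V (step F r) (proj₁ x) σ
    stay : ∀ d ts → expect (Distr.support (respond F p r d ts)) h ≡ V (step F r) p σ
    stay (yes c) _ = begin
        expect (Distr.support (point (p , candidate-serves F r p c))) h
      ≡⟨ expect-point (p , candidate-serves F r p c) h ⟩
        ℕtoℚ (dist p p) ℚ.+ V (step F r) p σ
      ≡⟨ cong (λ d → ℕtoℚ d ℚ.+ V (step F r) p σ) (dist-self p) ⟩
        0ℚ ℚ.+ V (step F r) p σ
      ≡⟨ ℚP.+-identityˡ (V (step F r) p σ) ⟩
        V (step F r) p σ
      ∎
      where open ≡-Reasoning
    stay (no nc) _ = ⊥-elim (nc c)

  V-move : ∀ F p r σ y → ¬ IsCandidate (step F r) p →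
           sumOf (λ Q → V (step F r) (anchor Q) σ) (layer (step F r)) ℚ.≤ ℕtoℚ (length (layer (step F r))) ℚ.* y →
           V F p (r ∷ σ) ℚ.≤ ℕtoℚ k ℚ.+ y
  V-move F p r σ y nc hy = move (candidate? (step F r) p) (targets F r) (targets-anchors F r)
    where
    F' = step F r
    g f : ServingCfg r → ℚ
    g x = ℕtoℚ (dist p (proj₁ x))
    f x = V F' (proj₁ x) σ
    move : ∀ d ts → map proj₁ ts ≡ map anchor (layer F') → expect (Distr.support (respond F p r d ts)) (λ x → g x ℚ.+ f x) ℚ.≤ ℕtoℚ k ℚ.+ y
    move (yes c) _ _ = ⊥-elim (nc c)
    move (no _) [] e = ⊥-elim (map-nonempty anchor (proj₂ (layer-nonempty F' (step-nonempty F r))) (sym e))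
    move (no _) (t ∷ ts) e =
      begin
        expect (Distr.support (uniform t ts)) (λ x → g x ℚ.+ f x)
      ≡⟨ expect-uniform t ts (λ x → g x ℚ.+ f x) ⟩
        sumOf (λ x → inv (suc (length ts)) ℚ.* (g x ℚ.+ f x)) (t ∷ ts)
      ≤⟨ average-bound (length ts) (t ∷ ts) f g (ℕtoℚ k) y refl (λ x _ → ℕtoℚ-mono (dist≤k p (proj₁ x))) future ⟩
        ℕtoℚ k ℚ.+ y
      ∎
      where
      open ℚP.≤-Reasoning
      same-length : length (layer F') ≡ suc (length ts)
      same-length = trans (sym (length-map anchor (layer F'))) (trans (cong length (sym e)) (length-map proj₁ (t ∷ ts)))
      future : sumOf f (t ∷ ts) ℚ.≤ ℕtoℚ (suc (length ts)) ℚ.* y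
      future = begin
          sumOf f (t ∷ ts)
        ≡⟨ sym (sum-map (λ q → V F' q σ) proj₁ (t ∷ ts)) ⟩
          sumOf (λ q → V F' q σ) (map proj₁ (t ∷ ts))
        ≡⟨ cong (sumOf (λ q → V F' q σ)) e ⟩
          sumOf (λ q → V F' q σ) (map anchor (layer F'))
        ≡⟨ sum-map (λ q → V F' q σ) anchor (layer F') ⟩
          sumOf (λ Q → V F' (anchor Q) σ) (layer F')
        ≤⟨ hy ⟩
          ℕtoℚ (length (layer F')) ℚ.* y
        ≡⟨ cong (λ l → ℕtoℚ l ℚ.* y) same-length ⟩
          ℕtoℚ (suc (length ts)) ℚ.* y
        ∎

module Log2 where

  open import Data.Nat.Logarithm using (⌊log₂_⌋; ⌊log₂⌋-mono-≤; ⌊log₂[2^n]⌋≡n)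

  below-next-power : ∀ m → m ℕ.< 2 ℕ.^ suc ⌊log₂ m ⌋
  below-next-power m = ℕP.≰⇒> λ 2^≤m →
    ℕP.<-irrefl refl (ℕP.≤-trans (ℕP.≤-reflexive (sym (⌊log₂[2^n]⌋≡n (suc ⌊log₂ m ⌋)))) (⌊log₂⌋-mono-≤ 2^≤m))

  1≤log₂ : ∀ m → 2 ℕ.≤ m → 1 ℕ.≤ ⌊log₂ m ⌋
  1≤log₂ m le = ℕP.≤-trans (ℕP.≤-reflexive (sym (⌊log₂[2^n]⌋≡n 1))) (⌊log₂⌋-mono-≤ le)

-- The harmonic
-- part is bounded by U, and dimension levels are spaced U + 1 apart, so a
-- drop of the maximal dimension releases at least 1 whatever happens to
-- the harmonic part.
module Potential (k' : ℕ) (n : Fin (suc k') → ℕ) (c₀ : Config (suc k') n) where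

  open Subspaces k' n c₀
  open Embedding
  open Harmonic
  open Log2
  open import Data.Nat.Logarithm using (⌊log₂_⌋)
  open import Data.Rational.Solver using (module +-*-Solver)
  open +-*-Solver

  U : ℕ
  U = suc (suc ⌊log₂ k ⌋ ℕ.* k)

  G : ℕ → ℕ
  G d = d ℕ.* suc U

  B : List Subspace → ℚ
  B F = H (length (layer F)) ℚ.+ ℕtoℚ (G (maxDim F))

  -- the constant by which the number of phases is multiplied
  cN : ℕ
  cN = k ℕ.* (suc U ℕ.+ G k)

  Good : List Subspace → Set
  Good F = Σ Subspace (_∈ F) × weight F ℕ.≤ k ℕ.^ k

  good-initial : Good [ whole ]
  good-initial = (whole , here refl) , ℕP.≤-reflexive weight-initial

  good-step : ∀ F r → Good F → Good (step F r)
  good-step F r (_ , w) = step-nonempty F r , weight-step F r w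

  H-layer≤U : ∀ F → Good F → H (length (layer F)) ℚ.≤ ℕtoℚ U
  H-layer≤U F (_ , w) = ℚP.≤-trans (H-mono (ℕP.≤-trans (length-layer F w) k^k≤2^)) (H-pow2 (suc ⌊log₂ k ⌋ ℕ.* k))
    where
    k^k≤2^ : k ℕ.^ k ℕ.≤ 2 ℕ.^ (suc ⌊log₂ k ⌋ ℕ.* k)
    k^k≤2^ = ℕP.≤-trans (ℕP.^-monoˡ-≤ k (ℕP.<⇒≤ (below-next-power k))) (ℕP.≤-reflexive (ℕP.^-*-assoc 2 (suc ⌊log₂ k ⌋) k))

  0≤B : ∀ F → 0ℚ ℚ.≤ B F
  0≤B F = 0≤+ (0≤H (length (layer F))) (0≤ℕtoℚ (G (maxDim F)))

  B-bounded : ∀ F → Good F → ℕtoℚ k ℚ.* (1ℚ ℚ.+ B F) ℚ.≤ ℕtoℚ cN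
  B-bounded F good = ℚP.≤-trans (*-monoˡ-0≤ (0≤ℕtoℚ k) le) (ℚP.≤-reflexive (sym (ℕtoℚ-* k (suc U ℕ.+ G k))))
    where
    open ℚP.≤-Reasoning
    le : 1ℚ ℚ.+ B F ℚ.≤ ℕtoℚ (suc U ℕ.+ G k)
    le = begin
        1ℚ ℚ.+ (H (length (layer F)) ℚ.+ ℕtoℚ (G (maxDim F)))
      ≤⟨ ℚP.+-monoʳ-≤ 1ℚ (ℚP.+-mono-≤ (H-layer≤U F good) (ℕtoℚ-mono (ℕP.*-monoˡ-≤ (suc U) (maxDim-≤ F k (λ Q _ → dim≤k Q))))) ⟩
        1ℚ ℚ.+ (ℕtoℚ U ℚ.+ ℕtoℚ (G k))
      ≡⟨ sym (trans (ℕtoℚ-+ 1 (U ℕ.+ G k)) (cong (1ℚ ℚ.+_) (ℕtoℚ-+ U (G k)))) ⟩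
        ℕtoℚ (suc U ℕ.+ G k)
      ∎

  B-drop : ∀ F F' → Good F' → maxDim F' ℕ.< maxDim F → 1ℚ ℚ.+ B F' ℚ.≤ B F
  B-drop F F' good lt =
    begin
      1ℚ ℚ.+ (H (length (layer F')) ℚ.+ ℕtoℚ (G (maxDim F')))
    ≤⟨ ℚP.+-monoʳ-≤ 1ℚ (ℚP.+-monoˡ-≤ _ (H-layer≤U F' good)) ⟩
      1ℚ ℚ.+ (ℕtoℚ U ℚ.+ ℕtoℚ (G (maxDim F')))
    ≡⟨ sym (trans (ℕtoℚ-+ 1 (U ℕ.+ G (maxDim F'))) (cong (1ℚ ℚ.+_) (ℕtoℚ-+ U (G (maxDim F'))))) ⟩
      ℕtoℚ (G (suc (maxDim F')))
    ≤⟨ ℕtoℚ-mono (ℕP.*-monoˡ-≤ (suc U) lt) ⟩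
      ℕtoℚ (G (maxDim F))
    ≤⟨ ℚP.≤-trans (ℚP.≤-reflexive (sym (ℚP.+-identityˡ _))) (ℚP.+-monoˡ-≤ _ (0≤H (length (layer F)))) ⟩
      B F
    ∎
    where open ℚP.≤-Reasoning

  B-shrink : ∀ F F' l → maxDim F' ≡ maxDim F → length (layer F') ℕ.+ l ≡ length (layer F) →
             ℕtoℚ (length (layer F)) ℚ.* B F' ℚ.+ ℕtoℚ l ℚ.≤ ℕtoℚ (length (layer F)) ℚ.* B F
  B-shrink F F' l same-dim el =
    begin
      m ℚ.* (H m' ℚ.+ g') ℚ.+ ℕtoℚ l
    ≡⟨ cong (λ z → m ℚ.* (H m' ℚ.+ ℕtoℚ (G z)) ℚ.+ ℕtoℚ l) same-dim ⟩
      m ℚ.* (H m' ℚ.+ g) ℚ.+ ℕtoℚ l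
    ≡⟨ solve 4 (λ m h g d → m :* (h :+ g) :+ d := (m :* h :+ d) :+ m :* g) refl m (H m') g (ℕtoℚ l) ⟩
      (m ℚ.* H m' ℚ.+ ℕtoℚ l) ℚ.+ m ℚ.* g
    ≤⟨ ℚP.+-monoˡ-≤ _ (subst (λ z → ℕtoℚ z ℚ.* H m' ℚ.+ ℕtoℚ l ℚ.≤ ℕtoℚ z ℚ.* H z) el (harmonic-gain m' l)) ⟩
      m ℚ.* H (length (layer F)) ℚ.+ m ℚ.* g
    ≡⟨ sym (ℚP.*-distribˡ-+ m _ g) ⟩
      m ℚ.* B F
    ∎
    where
    open ℚP.≤-Reasoning
    m = ℕtoℚ (length (layer F))
    m' = length (layer F')
    g' = ℕtoℚ (G (maxDim F'))
    g = ℕtoℚ (G (maxDim F))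

  B-mono : ∀ F F' → maxDim F' ≡ maxDim F → length (layer F') ℕ.≤ length (layer F) → B F' ℚ.≤ B F
  B-mono F F' same-dim le = ℚP.+-mono-≤ (H-mono le) (ℚP.≤-reflexive (cong (λ d → ℕtoℚ (G d)) same-dim))

-- With Φ F σ = cN · resets F σ + k · B F we show
-- by induction on σ that
--   (candidate bound) from a candidate position p of F, V F p σ ≤ Φ F σ + k;
--   (average bound)   the total of V F (anchor Q) σ over the top layer of F
--                     is at most (size of the top layer) · Φ F σ.
-- A request either ends the phase (paid by cN), lowers the maximal
-- dimension (paid by G), or removes the dead top-layer subspaces, whose
-- anchors are charged k + Φ each and paid by the harmonic part of B.
module Analysis (k' : ℕ) (n : Fin (suc k') → ℕ) (c₀ : Config (suc k') n) where

  open Subspaces k' n c₀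
  open Algorithm k' n c₀
  open Potential k' n c₀
  open Embedding
  open ListSums
  open import Data.List using (filter)
  open import Data.List.Membership.Propositional using (lose)
  open import Relation.Nullary using (Dec; yes; no; ¬?)
  open import Data.Rational.Solver using (module +-*-Solver)
  open +-*-Solver

  kq : ℚ
  kq = ℕtoℚ k

  Φ : List Subspace → List Cfg → ℚ
  Φ F σ = ℕtoℚ cN ℚ.* ℕtoℚ (resets F σ) ℚ.+ kq ℚ.* B F

  0≤Φ : ∀ F σ → 0ℚ ℚ.≤ Φ F σ
  0≤Φ F σ = 0≤+ (0≤* (0≤ℕtoℚ cN) (0≤ℕtoℚ (resets F σ))) (0≤* (0≤ℕtoℚ k) (0≤B F))

  Φ-rest : List Subspace → Cfg → List Cfg → ℚ
  Φ-rest F r σ = ℕtoℚ cN ℚ.* ℕtoℚ (resets (step F r) σ) ℚ.+ kq ℚ.* B F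

  Φ-cons : ∀ F r σ → Φ F (r ∷ σ) ≡ ℕtoℚ cN ℚ.* ℕtoℚ (restartCost (refineAll F r)) ℚ.+ Φ-rest F r σ
  Φ-cons F r σ =
    trans (cong (λ z → ℕtoℚ cN ℚ.* z ℚ.+ kq ℚ.* B F) (ℕtoℚ-+ (restartCost (refineAll F r)) (resets (step F r) σ)))
          (solve 5 (λ c a b k x → c :* (a :+ b) :+ k :* x := c :* a :+ (c :* b :+ k :* x)) refl
                 (ℕtoℚ cN) (ℕtoℚ (restartCost (refineAll F r))) (ℕtoℚ (resets (step F r) σ)) kq (B F))

  Φ-continue : ∀ F r σ → restartCost (refineAll F r) ≡ 0 → Φ F (r ∷ σ) ≡ Φ-rest F r σ
  Φ-continue F r σ e =
    begin
      Φ F (r ∷ σ)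
    ≡⟨ Φ-cons F r σ ⟩
      ℕtoℚ cN ℚ.* ℕtoℚ (restartCost (refineAll F r)) ℚ.+ Φ-rest F r σ
    ≡⟨ cong (λ c → ℕtoℚ cN ℚ.* ℕtoℚ c ℚ.+ Φ-rest F r σ) e ⟩
      ℕtoℚ cN ℚ.* 0ℚ ℚ.+ Φ-rest F r σ
    ≡⟨ cong (ℚ._+ Φ-rest F r σ) (ℚP.*-zeroʳ (ℕtoℚ cN)) ⟩
      0ℚ ℚ.+ Φ-rest F r σ
    ≡⟨ ℚP.+-identityˡ (Φ-rest F r σ) ⟩
      Φ-rest F r σ
    ∎
    where open ≡-Reasoning

  -- a restart is paid for by cN, since k · (1 + B) ≤ cN
  Φ-restart : ∀ F r σ → restartCost (refineAll F r) ≡ 1 → Good (step F r) → Φ (step F r) σ ℚ.+ kq ℚ.≤ Φ F (r ∷ σ)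
  Φ-restart F r σ e good =
    begin
      cN' ℚ.* R' ℚ.+ kq ℚ.* B F' ℚ.+ kq
    ≡⟨ solve 4 (λ c r k b → c :* r :+ k :* b :+ k := k :* (con 1ℚ :+ b) :+ (c :* r :+ con 0ℚ)) refl cN' R' kq (B F') ⟩
      kq ℚ.* (1ℚ ℚ.+ B F') ℚ.+ (cN' ℚ.* R' ℚ.+ 0ℚ)
    ≤⟨ ℚP.+-mono-≤ (ℚP.≤-trans (B-bounded F' good) (ℚP.≤-reflexive (sym (ℚP.*-identityʳ cN'))))
                   (ℚP.+-monoʳ-≤ (cN' ℚ.* R') (0≤* (0≤ℕtoℚ k) (0≤B F))) ⟩
      cN' ℚ.* 1ℚ ℚ.+ (cN' ℚ.* R' ℚ.+ kq ℚ.* B F)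
    ≡⟨ sym (trans (Φ-cons F r σ) (cong (λ c → cN' ℚ.* ℕtoℚ c ℚ.+ Φ-rest F r σ) e)) ⟩
      Φ F (r ∷ σ)
    ∎
    where
    open ℚP.≤-Reasoning
    F' = step F r
    cN' = ℕtoℚ cN
    R' = ℕtoℚ (resets F' σ)

  -- a drop of the maximal dimension is paid for by G
  Φ-drop : ∀ F r σ → restartCost (refineAll F r) ≡ 0 → Good (step F r) → maxDim (step F r) ℕ.< maxDim F →
           Φ (step F r) σ ℚ.+ kq ℚ.≤ Φ F (r ∷ σ)
  Φ-drop F r σ e good lt =
    begin
      cN' ℚ.* R' ℚ.+ kq ℚ.* B F' ℚ.+ kq
    ≡⟨ solve 4 (λ c r k b → c :* r :+ k :* b :+ k := c :* r :+ k :* (con 1ℚ :+ b)) refl cN' R' kq (B F') ⟩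
      cN' ℚ.* R' ℚ.+ kq ℚ.* (1ℚ ℚ.+ B F')
    ≤⟨ ℚP.+-monoʳ-≤ (cN' ℚ.* R') (*-monoˡ-0≤ (0≤ℕtoℚ k) (B-drop F F' good lt)) ⟩
      cN' ℚ.* R' ℚ.+ kq ℚ.* B F
    ≡⟨ sym (Φ-continue F r σ e) ⟩
      Φ F (r ∷ σ)
    ∎
    where
    open ℚP.≤-Reasoning
    F' = step F r
    cN' = ℕtoℚ cN
    R' = ℕtoℚ (resets F' σ)

  Φ-same : ∀ F r σ → restartCost (refineAll F r) ≡ 0 → B (step F r) ℚ.≤ B F → Φ (step F r) σ ℚ.≤ Φ F (r ∷ σ)
  Φ-same F r σ e le = ℚP.≤-trans (ℚP.+-monoʳ-≤ (ℕtoℚ cN ℚ.* ℕtoℚ (resets (step F r) σ)) (*-monoˡ-0≤ (0≤ℕtoℚ k) le)) (ℚP.≤-reflexive (sym (Φ-continue F r σ e)))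

  Φ-average : ∀ F r σ l → restartCost (refineAll F r) ≡ 0 → maxDim (step F r) ≡ maxDim F →
              length (layer (step F r)) ℕ.+ l ≡ length (layer F) →
              ℕtoℚ (length (layer (step F r))) ℚ.* Φ (step F r) σ ℚ.+ ℕtoℚ l ℚ.* (kq ℚ.+ Φ (step F r) σ)
                ℚ.≤ ℕtoℚ (length (layer F)) ℚ.* Φ F (r ∷ σ)
  Φ-average F r σ l e same-dim el =
    begin
      M' ℚ.* (c ℚ.* R ℚ.+ kq ℚ.* B F') ℚ.+ L ℚ.* (kq ℚ.+ (c ℚ.* R ℚ.+ kq ℚ.* B F'))
    ≡⟨ solve 6 (λ M' L c R k b → M' :* (c :* R :+ k :* b) :+ L :* (k :+ (c :* R :+ k :* b))
                               := (M' :+ L) :* (c :* R) :+ k :* ((M' :+ L) :* b :+ L)) refl M' L c R kq (B F') ⟩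
      (M' ℚ.+ L) ℚ.* (c ℚ.* R) ℚ.+ kq ℚ.* ((M' ℚ.+ L) ℚ.* B F' ℚ.+ L)
    ≡⟨ cong (λ z → z ℚ.* (c ℚ.* R) ℚ.+ kq ℚ.* (z ℚ.* B F' ℚ.+ L)) (trans (sym (ℕtoℚ-+ (length (layer F')) l)) (cong ℕtoℚ el)) ⟩
      M ℚ.* (c ℚ.* R) ℚ.+ kq ℚ.* (M ℚ.* B F' ℚ.+ L)
    ≤⟨ ℚP.+-monoʳ-≤ (M ℚ.* (c ℚ.* R)) (*-monoˡ-0≤ (0≤ℕtoℚ k) (B-shrink F F' l same-dim el)) ⟩
      M ℚ.* (c ℚ.* R) ℚ.+ kq ℚ.* (M ℚ.* B F)
    ≡⟨ solve 5 (λ M c R k b → M :* (c :* R) :+ k :* (M :* b) := M :* (c :* R :+ k :* b)) refl M c R kq (B F) ⟩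
      M ℚ.* (c ℚ.* R ℚ.+ kq ℚ.* B F)
    ≡⟨ cong (M ℚ.*_) (sym (Φ-continue F r σ e)) ⟩
      M ℚ.* Φ F (r ∷ σ)
    ∎
    where
    open ℚP.≤-Reasoning
    F' = step F r
    c = ℕtoℚ cN
    R = ℕtoℚ (resets F' σ)
    M = ℕtoℚ (length (layer F))
    M' = ℕtoℚ (length (layer F'))
    L = ℕtoℚ l

  CandidateBound : List Cfg → List Subspace → Set
  CandidateBound σ F = ∀ p → IsCandidate F p → V F p σ ℚ.≤ Φ F σ ℚ.+ kq

  AverageBound : List Cfg → List Subspace → Set
  AverageBound σ F = sumOf (λ Q → V F (anchor Q) σ) (layer F) ℚ.≤ ℕtoℚ (length (layer F)) ℚ.* Φ F σ

  Claims : List Cfg → List Subspace → Set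
  Claims σ F = CandidateBound σ F × AverageBound σ F

  ≤+kq : ∀ x → x ℚ.≤ x ℚ.+ kq
  ≤+kq x = ℚP.≤-trans (ℚP.≤-reflexive (sym (ℚP.+-identityʳ x))) (ℚP.+-monoʳ-≤ x (0≤ℕtoℚ k))

  claims-[] : ∀ F → Claims [] F
  claims-[] F = (λ p _ → ℚP.≤-trans (0≤Φ F []) (≤+kq (Φ F [])))
              , sum-bound (λ _ → 0ℚ) (Φ F []) (layer F) (λ _ _ → 0≤Φ F [])

  V-any : ∀ F r σ → Claims σ (step F r) → ∀ p → V F p (r ∷ σ) ℚ.≤ Φ (step F r) σ ℚ.+ kq
  V-any F r σ (cand , avg) p = by-cases (candidate? (step F r) p)
    where
    by-cases : Dec (IsCandidate (step F r) p) → V F p (r ∷ σ) ℚ.≤ Φ (step F r) σ ℚ.+ kq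
    by-cases (yes c) = subst (ℚ._≤ Φ (step F r) σ ℚ.+ kq) (sym (V-stay F p r σ c)) (cand p c)
    by-cases (no nc) = ℚP.≤-trans (V-move F p r σ (Φ (step F r) σ) nc avg) (ℚP.≤-reflexive (ℚP.+-comm kq (Φ (step F r) σ)))

  claims-paid : ∀ F r σ → Claims σ (step F r) → Φ (step F r) σ ℚ.+ kq ℚ.≤ Φ F (r ∷ σ) → Claims (r ∷ σ) F
  claims-paid F r σ ih paid =
    (λ p _ → ℚP.≤-trans (V-any F r σ ih p) (ℚP.≤-trans paid (≤+kq (Φ F (r ∷ σ)))))
    , sum-bound (λ Q → V F (anchor Q) (r ∷ σ)) (Φ F (r ∷ σ)) (layer F) (λ Q _ → ℚP.≤-trans (V-any F r σ ih (anchor Q)) paid)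

  -- the phase continues on the same level: the new top layer is the
  -- surviving part of the old one; surviving anchors stay, dead ones move
  claims-same : ∀ F r σ → Claims σ (step F r) → restartCost (refineAll F r) ≡ 0 → step F r ≡ refineAll F r →
                maxDim (step F r) ≡ maxDim F → Claims (r ∷ σ) F
  claims-same F r σ ih@(cand , avg) e step≡ same-dim = candidates , averages
    where
    F' = step F r
    alive dead : List Subspace
    alive = filter (survives? r) (layer F)
    dead = filter (¬? ∘ survives? r) (layer F)
    layer≡ : layer F' ≡ alive
    layer≡ = trans (cong layer step≡) (layer-refineAll F r (trans (cong maxDim (sym step≡)) same-dim))
    split : length (layer F') ℕ.+ length dead ≡ length (layer F)
    split = trans (cong (λ L → length L ℕ.+ length dead) layer≡) (length-filter-split (survives? r) (layer F))
    candidates : CandidateBound (r ∷ σ) F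
    candidates p _ = ℚP.≤-trans (V-any F r σ ih p) (ℚP.+-monoˡ-≤ kq (Φ-same F r σ e (B-mono F F' same-dim
      (ℕP.≤-trans (ℕP.m≤m+n (length (layer F')) (length dead)) (ℕP.≤-reflexive split)))))
    stays : ∀ Q → Q ∈ alive → V F (anchor Q) (r ∷ σ) ≡ V F' (anchor Q) σ
    stays Q m = V-stay F (anchor Q) r σ (lose (subst (Q ∈_) (sym layer≡) m) (λ i → refl))
    alive-total : sumOf (λ Q → V F (anchor Q) (r ∷ σ)) alive ℚ.≤ ℕtoℚ (length (layer F')) ℚ.* Φ F' σ
    alive-total = ℚP.≤-trans (ℚP.≤-reflexive (trans (sum-cong (λ Q → V F (anchor Q) (r ∷ σ)) (λ Q → V F' (anchor Q) σ) alive stays) (cong (sumOf (λ Q → V F' (anchor Q) σ)) (sym layer≡)))) avg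
    dead-total : sumOf (λ Q → V F (anchor Q) (r ∷ σ)) dead ℚ.≤ ℕtoℚ (length dead) ℚ.* (kq ℚ.+ Φ F' σ)
    dead-total = sum-bound (λ Q → V F (anchor Q) (r ∷ σ)) (kq ℚ.+ Φ F' σ) dead (λ Q _ → ℚP.≤-trans (V-any F r σ ih (anchor Q)) (ℚP.≤-reflexive (ℚP.+-comm (Φ F' σ) kq)))
    averages : AverageBound (r ∷ σ) F
    averages = ℚP.≤-trans (ℚP.≤-reflexive (sum-filter-split (survives? r) (λ Q → V F (anchor Q) (r ∷ σ)) (layer F)))
                   (ℚP.≤-trans (ℚP.+-mono-≤ alive-total dead-total) (Φ-average F r σ (length dead) e same-dim split))

  claims-step : ∀ F r σ → Good F → Claims σ (step F r) → Claims (r ∷ σ) F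
  claims-step F r σ good ih = by-case (step-cases F r)
    where
    F' = step F r
    by-level : restartCost (refineAll F r) ≡ 0 → F' ≡ refineAll F r → maxDim F' ℕ.< maxDim F ⊎ maxDim F' ≡ maxDim F → Claims (r ∷ σ) F
    by-level continued step≡ (inj₁ dropped) = claims-paid F r σ ih (Φ-drop F r σ continued (good-step F r good) dropped)
    by-level continued step≡ (inj₂ same-dim) = claims-same F r σ ih continued step≡ same-dim
    by-case : (restartCost (refineAll F r) ≡ 1) ⊎ (restartCost (refineAll F r) ≡ 0 × F' ≡ refineAll F r) → Claims (r ∷ σ) F
    by-case (inj₁ restarted) = claims-paid F r σ ih (Φ-restart F r σ restarted (good-step F r good))
    by-case (inj₂ (continued , step≡)) =
      by-level continued step≡ (ℕP.m≤n⇒m<n∨m≡n (subst (λ G → maxDim G ℕ.≤ maxDim F) (sym step≡) (maxDim-refineAll F r)))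

  claims : ∀ σ F → Good F → Claims σ F
  claims [] F good = claims-[] F
  claims (r ∷ σ) F good = claims-step F r σ good (claims σ (step F r) (good-step F r good))

module Competitiveness (k' : ℕ) (n : Fin (suc k') → ℕ) (c₀ : Config (suc k') n) where

  open Subspaces k' n c₀
  open Algorithm k' n c₀
  open Potential k' n c₀
  open Analysis k' n c₀
  open Embedding
  open Log2
  open import Data.Nat.Logarithm using (⌊log₂_⌋)
  open import Data.List.Membership.Propositional using (lose)

  initial-candidate : IsCandidate [ whole ] c₀
  initial-candidate with layer-nonempty [ whole ] (whole , here refl)
  ... | Q , m with proj₁ (∈-layer [ whole ] m)
  ...   | here refl = lose m (λ i → refl)

  alg-bound : ∀ σ τ → Feasible σ τ → ALGcost alg c₀ σ ℚ.≤ ℕtoℚ cN ℚ.* ℕtoℚ (trajCost c₀ τ) ℚ.+ ℕtoℚ cN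
  alg-bound σ τ fe =
    begin
      ALGcost alg c₀ σ
    ≡⟨ expCost≡V σ [] ⟩
      V [ whole ] c₀ σ
    ≤⟨ proj₁ (claims σ [ whole ] good-initial) c₀ initial-candidate ⟩
      c ℚ.* ℕtoℚ (resets [ whole ] σ) ℚ.+ kq ℚ.* B [ whole ] ℚ.+ kq
    ≡⟨ solve 4 (λ c r k b → c :* r :+ k :* b :+ k := c :* r :+ k :* (con 1ℚ :+ b)) refl c (ℕtoℚ (resets [ whole ] σ)) kq (B [ whole ]) ⟩
      c ℚ.* ℕtoℚ (resets [ whole ] σ) ℚ.+ kq ℚ.* (1ℚ ℚ.+ B [ whole ])
    ≤⟨ ℚP.+-mono-≤ (*-monoˡ-0≤ (0≤ℕtoℚ cN) (ℕtoℚ-mono (resets-covered fe [ whole ] c₀ (whole , here refl , λ i v ()))))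
                   (B-bounded [ whole ] good-initial) ⟩
      c ℚ.* ℕtoℚ (trajCost c₀ τ) ℚ.+ c
    ∎
    where
    open ℚP.≤-Reasoning
    open import Data.Rational.Solver using (module +-*-Solver)
    open +-*-Solver
    c = ℕtoℚ cN

  cN≤ : 1 ℕ.≤ k' → cN ℕ.≤ 6 ℕ.* k ℕ.^ 3 ℕ.* ⌊log₂ k ⌋
  cN≤ 1≤k' =
    begin
      k ℕ.* (suc k ℕ.* suc U)
    ≤⟨ ℕP.*-monoʳ-≤ k (ℕP.*-mono-≤ 1+k≤2k 1+U≤3kL) ⟩
      k ℕ.* ((2 ℕ.* k) ℕ.* (3 ℕ.* k ℕ.* L))
    ≡⟨ solve 2 (λ k L → k :* ((con 2 :* k) :* (con 3 :* k :* L)) := con 6 :* k :^ 3 :* L) refl k L ⟩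
      6 ℕ.* k ℕ.^ 3 ℕ.* L
    ∎
    where
    open ℕP.≤-Reasoning
    open import Data.Nat.Solver using (module +-*-Solver)
    open +-*-Solver
    L = ⌊log₂ k ⌋
    1+k≤2k : suc k ℕ.≤ 2 ℕ.* k
    1+k≤2k = ℕP.≤-trans (ℕP.+-monoˡ-≤ k (ℕ.s≤s (ℕ.z≤n {k'}))) (ℕP.≤-reflexive (cong (k ℕ.+_) (sym (ℕP.+-identityʳ k))))
    k≤kL : k ℕ.≤ k ℕ.* L
    k≤kL = ℕP.≤-trans (ℕP.≤-reflexive (sym (ℕP.*-identityʳ k))) (ℕP.*-monoʳ-≤ k (1≤log₂ k (ℕ.s≤s 1≤k')))
    1+U≤3kL : suc U ℕ.≤ 3 ℕ.* k ℕ.* L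
    1+U≤3kL = begin
        2 ℕ.+ (k ℕ.+ L ℕ.* k)
      ≤⟨ ℕP.+-mono-≤ (ℕP.≤-trans (ℕ.s≤s 1≤k') k≤kL) (ℕP.+-mono-≤ k≤kL (ℕP.≤-reflexive (ℕP.*-comm L k))) ⟩
        k ℕ.* L ℕ.+ (k ℕ.* L ℕ.+ k ℕ.* L)
      ≡⟨ solve 2 (λ k L → k :* L :+ (k :* L :+ k :* L) := con 3 :* k :* L) refl k L ⟩
        3 ℕ.* k ℕ.* L
      ∎

  competitive : 1 ℕ.≤ k' → Competitive (ℕtoℚ (6 ℕ.* k ℕ.^ 3 ℕ.* ⌊log₂ k ⌋)) alg c₀
  competitive 1≤k' = ℕtoℚ cN , λ σ τ fe →
    ℚP.≤-trans (alg-bound σ τ fe) (ℚP.+-monoˡ-≤ (ℕtoℚ cN) (*-monoʳ-0≤ (0≤ℕtoℚ (trajCost c₀ τ)) (ℕtoℚ-mono (cN≤ 1≤k'))))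

open import Data.Nat using (_≤_; _*_; _^_)
open import Data.Nat.Logarithm using (⌊log₂_⌋)

theorem2 : ∃ λ (C : ℕ) → ∃ λ (k₀ : ℕ) → ∀ (k : ℕ) → k₀ ≤ k →
    ∀ (n : Fin k → ℕ) (c₀ : Config k n) →
    Σ (RandAlg k n) λ A → Competitive (ℕtoℚ (C * k ^ 3 * ⌊log₂ k ⌋)) A c₀
theorem2 = 6 , 2 , for-k≥2
  where
  for-k≥2 : ∀ (k : ℕ) → 2 ≤ k → ∀ (n : Fin k → ℕ) (c₀ : Config k n) →
            Σ (RandAlg k n) λ A → Competitive (ℕtoℚ (6 * k ^ 3 * ⌊log₂ k ⌋)) A c₀
  for-k≥2 (suc k') (ℕ.s≤s 1≤k') n c₀ = Algorithm.alg k' n c₀ , Competitiveness.competitive k' n c₀ 1≤k'
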